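{- Let $D\geq 2$ be a square-free integer, $K=\mathbb{Q}(\sqrt{D})$, and let $p$ be a prime with $\gcd(p,6D)=1$. Suppose that $p$ divides some $d_k(D)$, $k\geq 1$, and let $\ell\geq 1$ be the least index such that $p\mid d_\ell(D)$; let $r\geq1$ be such that $p^r$ exactly divides $d_\ell(D)$. If $p^2\mid d_\ell(D)$, then the pair $p,K$ satisfies condition $(\mathbf{W})$, i.e. $\mathrm{ord}_p(u_K)=\mathrm{ord}_{p^2}(u_K)$.
   Context: Let $\mathbb{Z}_K$ be the ring of integers of $K=\mathbb{Q}(\sqrt{D})$, and let $u_K$ be the fundamental unit of $K$ with $u_K>1$ under the real embedding with $\sqrt{D}>0$. Let $u_D=u_K^2$ if $K$ has a unit of norm $-1$, and $u_D=u_K$ otherwise (so $u_D$ is the first totally positive power of $u_K$). For $\ell\geq 1$ define the integer $d_\ell(D)=u_D^\ell+u_D^{ -\ell}+1$. For an ideal $\mathcal{J}$ of $\mathbb{Z}_K$ and a unit $\epsilon$, $\mathrm{ord}_{\mathcal{J}}(\epsilon)$ denotes the order of $\epsilon$ in $(\mathbb{Z}_K/\mathcal{J})^\times$; $\mathrm{ord}_p$ and $\mathrm{ord}_{p^2}$ refer to $\mathcal{J}=p\mathbb{Z}_K$ and $p^2\mathbb{Z}_K$. -}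

module Defs where

open import Data.Nat as ℕ using (ℕ; zero; suc)
open import Data.Nat.DivMod using (_%_; _/_)
open import Data.Integer as ℤ using (ℤ; +_; _+_; _*_; -_; _-_; _<_; _≤_)
open import Data.Integer.Divisibility using (_∣_)
open import Data.Bool using (if_then_else_)
open import Data.Product using (_×_; _,_; proj₁; proj₂; Σ; ∃)
open import Data.Sum using (_⊎_)
open import Relation.Binary.PropositionalEquality using (_≡_)
open import Relation.Nullary using (¬_)

SquareFree : ℕ → Set
SquareFree D = ∀ (m : ℕ) → (m ℕ.* m) Data.Nat.Divisibility.∣ D → m ≡ 1
  where import Data.Nat.Divisibility

-- Integral basis {1, ω} of Z_K, K = Q(√D):
--   ω = (1+√D)/2 if D ≡ 1 (mod 4), with ω² = ω + (D-1)/4,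
--   ω = √D otherwise,               with ω² = D.
-- So ω² = tr·ω + nm, ω = (tr + √D)/2.
tr : ℕ → ℤ
tr D = if (D % 4) ℕ.≡ᵇ 1 then + 1 else + 0

nm : ℕ → ℤ
nm D = if (D % 4) ℕ.≡ᵇ 1 then + ((D ℕ.∸ 1) / 4) else + D

-- An element a + b ω of Z_K is the pair (a , b).
OK : Set
OK = ℤ × ℤ

oneK : OK
oneK = (+ 1 , + 0)

addK : OK → OK → OK
addK (a , b) (c , d) = (a + c , b + d)

subK : OK → OK → OK
subK (a , b) (c , d) = (a - c , b - d)

mulK : ℕ → OK → OK → OK
mulK D (a , b) (c , d) = (a * c + b * d * nm D , a * d + b * c + b * d * tr D)

-- Galois conjugate: ω ↦ tr - ω.
conjK : ℕ → OK → OK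
conjK D (a , b) = (a + b * tr D , - b)

normK : ℕ → OK → ℤ
normK D (a , b) = a * a + a * b * tr D - b * b * nm D

scaleK : ℤ → OK → OK
scaleK k (a , b) = (k * a , k * b)

IsUnit : ℕ → OK → Set
IsUnit D u = normK D u ≡ + 1 ⊎ normK D u ≡ - (+ 1)

-- Inverse of a unit u: u⁻¹ = N(u) · conj(u)  (valid since N(u) = ±1).
invK : ℕ → OK → OK
invK D u = scaleK (normK D u) (conjK D u)

powK : ℕ → OK → ℕ → OK
powK D u zero = oneK
powK D u (suc n) = mulK D u (powK D u n)

zpowK : ℕ → OK → ℤ → OK
zpowK D u (+ n) = powK D u n
zpowK D u ℤ.-[1+ n ] = powK D (invK D u) (suc n)

-- x + y√D > 0 (D ≥ 2 not a square), by cases on the signs of x, y.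
PosSqrt : ℕ → ℤ → ℤ → Set
PosSqrt D x y =
    (+ 0 ≤ x × + 0 ≤ y × ¬ (x ≡ + 0 × y ≡ + 0))
  ⊎ (+ 0 < x × y < + 0 × + D * y * y < x * x)
  ⊎ (x < + 0 × + 0 < y × x * x < + D * y * y)

-- The real embedding (√D > 0) of a + bω is ((2a + b·tr) + b√D)/2.
Positive : ℕ → OK → Set
Positive D (a , b) = PosSqrt D (+ 2 * a + b * tr D) b

GreaterOne : ℕ → OK → Set
GreaterOne D u = Positive D (subK u oneK)

IsFundamentalUnit : ℕ → OK → Set
IsFundamentalUnit D u =
  IsUnit D u × GreaterOne D u ×
  (∀ (v : OK) → IsUnit D v →
     ∃ λ (n : ℤ) → v ≡ zpowK D u n ⊎ v ≡ scaleK (- (+ 1)) (zpowK D u n))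

HasNormMinusOneUnit : ℕ → Set
HasNormMinusOneUnit D = ∃ λ (v : OK) → normK D v ≡ - (+ 1)

IsUD : ℕ → OK → OK → Set
IsUD D uK uD = (HasNormMinusOneUnit D → uD ≡ mulK D uK uK)
             × (¬ HasNormMinusOneUnit D → uD ≡ uK)

-- d_ℓ(D) = u_D^ℓ + u_D^{-ℓ} + 1, as an element of Z_K (it lies in ℤ).
dK : ℕ → OK → ℕ → OK
dK D uD ℓ = addK (addK (powK D uD ℓ) (powK D (invK D uD) ℓ)) oneK

-- Divisibility in Z_K by a rational integer m: x ∈ m Z_K.
DivK : ℤ → OK → Set
DivK m (a , b) = (m ∣ a) × (m ∣ b)

CongK : ℤ → OK → OK → Set
CongK m x y = DivK m (subK x y)

IsOrd : ℕ → ℤ → OK → ℕ → Set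
IsOrd D m ε n =
  1 ℕ.≤ n × CongK m (powK D ε n) oneK ×
  (∀ k → 1 ℕ.≤ k → k ℕ.< n → ¬ CongK m (powK D ε k) oneK)

{-# OPTIONS --safe #-}
-- Write v = u_D, a unit of norm 1, and d(x) = x + x̄ + 1, so that d_k = d(v^k). For x of norm 1,
-- x³ - 1 = (x - 1)·x·d(x) and 3 = d(x) + (x - 1)(x̄ - 1). Hence p ∣ d_ℓ gives v^(3ℓ) ≡ 1 (mod p),
-- and the order t of v mod p divides 3ℓ but not ℓ (otherwise p ∣ 3), so t = 3s with s ∣ ℓ. Since
-- (v^s - 1)·v^s·d(v^s) ≡ 0 (mod p), v^s ≢ 1 and d(v^s) is a rational integer, p divides d_s, so
-- s = ℓ by minimality: ord_p(v) = 3ℓ. Since p² ∣ d_ℓ also gives v^(3ℓ) ≡ 1 (mod p²), every power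
-- of v that is 1 mod p is 1 mod p². Finally u_D = u_K or u_K², and for odd p, w ≡ 1 (mod p) together
-- with w² ≡ 1 (mod p²) forces w ≡ 1 (mod p²); with w = u_K^n, n = ord_p(u_K), this is condition (W).
module Submission where

open import Defs
open import Data.Nat using (ℕ; _≤_; _<_; _*_; _^_)
open import Data.Nat.GCD using (gcd)
open import Data.Nat.Primality using (Prime)
open import Data.Integer using (+_)
open import Data.Product using (_×_; ∃)
open import Relation.Binary.PropositionalEquality using (_≡_)
open import Relation.Nullary using (¬_)

open import Algebra.Bundles using (CommutativeRing)
open import Algebra.Consequences.Propositional
  using (comm∧idˡ⇒id; comm∧invˡ⇒inv; comm∧distrˡ⇒distrʳ)
open import Algebra.Structures using (IsCommutativeRing)
import Algebra.Solver.Ring.AlmostCommutativeRing as ACR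
import Algebra.Solver.Ring.Simple as RingSolver
open import Data.Empty using (⊥-elim)
open import Data.Integer as ℤ using (ℤ)
import Data.Integer.Divisibility.Signed as ℤS
import Data.Integer.Properties as ℤP
open import Data.Integer.Solver using (module +-*-Solver)
open import Data.Nat as ℕ using (zero; suc; z≤n; s≤s)
open import Data.Nat.Coprimality using (gcd≡1⇒coprime)
open import Data.Nat.DivMod using (_%_; _/_; m≡m%n+[m/n]*n; m%n<n)
open import Data.Nat.Divisibility
  using ( _∣_; divides; 1∣_; ∣-refl; ∣-trans; ∣⇒≤; m∣m*n; *-pres-∣; *-monoʳ-∣; *-cancelˡ-∣
        ; m%n≡0⇒n∣m)
open import Data.Nat.Induction using (<-rec)
import Data.Nat.Properties as ℕP
open import Data.Nat.Primality using (euclidsLemma; prime?; prime⇒nonZero; ¬prime[1])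
open import Data.Product using (_,_; proj₁; proj₂; uncurry)
import Data.Product.Properties as Product
open import Data.Sum using (_⊎_; inj₁; inj₂)
import Data.Sum as Sum
open import Relation.Binary.PropositionalEquality
  using (refl; sym; trans; cong; cong₂; subst; subst₂)
open import Relation.Binary.PropositionalEquality.Algebra using (isMagma)
open import Relation.Nullary using (Dec; yes; no)
import Relation.Nullary.Decidable as Dec
open import Relation.Nullary.Decidable using (decidable-stable; from-yes; _×-dec_)
open import Relation.Nullary.Negation using (¬¬-map)
open import Relation.Unary using (Decidable)
open import Function using (id; _∘_)

least : ∀ {P : ℕ → Set} → Decidable P → ∀ {n} → P n → ∃ λ m → P m × (∀ {k} → k < m → ¬ P k)
least {P} P? {n} = <-rec Least step n
  where
    Least : ℕ → Set
    Least n = P n → ∃ λ m → P m × (∀ {k} → k < m → ¬ P k)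
    step : ∀ n → (∀ {k} → k < n → Least k) → Least n
    step n smaller Pn with ℕP.anyUpTo? P? n
    ... | yes (k , k<n , Pk) = smaller k<n Pk
    ... | no none = n , Pn , λ k<n Pk → none (_ , k<n , Pk)

∣p*n∧∤n⇒≡p* : ∀ {p m n} → Prime p → m ∣ p * n → ¬ m ∣ n → ∃ λ s → m ≡ p * s × s ∣ n
∣p*n∧∤n⇒≡p* {p} {m} {n} p-prime m∣pn@(divides c pn≡cm) m∤n
  with euclidsLemma c m p-prime (divides n (trans (sym pn≡cm) (ℕP.*-comm p n)))
... | inj₁ (divides c′ refl) =
  ⊥-elim (m∤n (*-cancelˡ-∣ p {{prime⇒nonZero p-prime}}
                 (divides c′ (trans pn≡cm (ℕP.*-assoc c′ p m)))))
... | inj₂ (divides s refl) = s , ℕP.*-comm s p ,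
  *-cancelˡ-∣ p {{prime⇒nonZero p-prime}} (subst (_∣ p * n) (ℕP.*-comm s p) m∣pn)

gcd≡1∧k∣n⇒p∤k : ∀ {p n k} → Prime p → gcd p n ≡ 1 → k ∣ n → ¬ p ∣ k
gcd≡1∧k∣n⇒p∤k p-prime gcd≡1 k∣n p∣k =
  ¬prime[1] (subst Prime (gcd≡1⇒coprime gcd≡1 (∣-refl , ∣-trans p∣k k∣n)) p-prime)

euclidsLemmaℤ : ∀ {p} m n → Prime p → + p ℤS.∣ m ℤ.* n → + p ℤS.∣ m ⊎ + p ℤS.∣ n
euclidsLemmaℤ {p} m n p-prime p∣mn = Sum.map ℤS.∣ᵤ⇒∣ ℤS.∣ᵤ⇒∣
  (euclidsLemma ℤ.∣ m ∣ ℤ.∣ n ∣ p-prime (subst (p ∣_) (ℤP.abs-* m n) (ℤS.∣⇒∣ᵤ p∣mn)))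

*-pres-∣ℤ : ∀ {m n a b} → m ℤS.∣ a → n ℤS.∣ b → m ℤ.* n ℤS.∣ a ℤ.* b
*-pres-∣ℤ {m} {n} {a} {b} m∣a n∣b = ℤS.∣ᵤ⇒∣ (subst₂ _∣_ (sym (ℤP.abs-* m n)) (sym (ℤP.abs-* a b))
                                                   (*-pres-∣ (ℤS.∣⇒∣ᵤ m∣a) (ℤS.∣⇒∣ᵤ n∣b)))

p∣a∧p*p∣c*a⇒p*p∣a : ∀ {p c a} → Prime p → ¬ + p ℤS.∣ c → + p ℤS.∣ a →
                    + p ℤ.* + p ℤS.∣ c ℤ.* a → + p ℤ.* + p ℤS.∣ a
p∣a∧p*p∣c*a⇒p*p∣a {p} {c} p-prime p∤c (ℤS.divides k refl) pp∣ckp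
  with euclidsLemmaℤ c k p-prime
         (ℤS.*-cancelˡ-∣ (+ p) {{prime⇒nonZero p-prime}} (subst (_ ℤS.∣_) regroup pp∣ckp))
  where
    regroup : c ℤ.* (k ℤ.* + p) ≡ + p ℤ.* (c ℤ.* k)
    regroup = trans (sym (ℤP.*-assoc c k (+ p))) (ℤP.*-comm (c ℤ.* k) (+ p))
... | inj₁ p∣c = ⊥-elim (p∤c p∣c)
... | inj₂ p∣k = ℤS.*-monoˡ-∣ (+ p) p∣k

-- DivK with signed divisibility, as a record so that its indices can be inferred.
infix 4 _∣ᴷ_

record _∣ᴷ_ (m : ℤ) (x : OK) : Set where
  constructor _,_
  field
    ∣proj₁ : m ℤS.∣ proj₁ x
    ∣proj₂ : m ℤS.∣ proj₂ x

DivK⇒∣ᴷ : ∀ {m x} → DivK m x → m ∣ᴷ x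
DivK⇒∣ᴷ (m∣a , m∣b) = ℤS.∣ᵤ⇒∣ m∣a , ℤS.∣ᵤ⇒∣ m∣b

∣ᴷ⇒DivK : ∀ {m x} → m ∣ᴷ x → DivK m x
∣ᴷ⇒DivK (m∣a , m∣b) = ℤS.∣⇒∣ᵤ m∣a , ℤS.∣⇒∣ᵤ m∣b

∣ᴷ? : ∀ m x → Dec (m ∣ᴷ x)
∣ᴷ? m (a , b) =
  Dec.map′ (uncurry _,_) (λ (m∣a , m∣b) → m∣a , m∣b) ((m ℤS.∣? a) ×-dec (m ℤS.∣? b))

-- ℤ × ℤ read as ℤ[ω] with ω² = tω + n; for t = tr D and n = nm D the operations
-- below are definitionally addK, mulK D, conjK D and normK D.
module QuadraticRing (t n : ℤ) where

  infixl 6 _+_ _-_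
  infixl 7 _·_
  infix  8 -_

  _+_ : OK → OK → OK
  _+_ = addK

  _·_ : OK → OK → OK
  (a , b) · (c , d) = (a ℤ.* c ℤ.+ b ℤ.* d ℤ.* n , a ℤ.* d ℤ.+ b ℤ.* c ℤ.+ b ℤ.* d ℤ.* t)

  -_ : OK → OK
  - (a , b) = (ℤ.- a , ℤ.- b)

  _-_ : OK → OK → OK
  x - y = x + - y

  0# 1# : OK
  0# = (+ 0 , + 0)
  1# = oneK

  ι : ℤ → OK
  ι c = (c , + 0)

  conj : OK → OK
  conj (a , b) = (a ℤ.+ b ℤ.* t , ℤ.- b)

  norm : OK → ℤ
  norm (a , b) = a ℤ.* a ℤ.+ a ℤ.* b ℤ.* t ℤ.- b ℤ.* b ℤ.* n

  d : OK → OK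
  d x = x + conj x + 1#

  open import Algebra.Definitions {A = OK} _≡_

  +-assoc : Associative _+_
  +-assoc (a , b) (c , d) (e , f) = cong₂ _,_ (ℤP.+-assoc a c e) (ℤP.+-assoc b d f)

  +-comm : Commutative _+_
  +-comm (a , b) (c , d) = cong₂ _,_ (ℤP.+-comm a c) (ℤP.+-comm b d)

  +-identityˡ : LeftIdentity 0# _+_
  +-identityˡ (a , b) = cong₂ _,_ (ℤP.+-identityˡ a) (ℤP.+-identityˡ b)

  -‿inverseˡ : LeftInverse 0# -_ _+_
  -‿inverseˡ (a , b) = cong₂ _,_ (ℤP.+-inverseˡ a) (ℤP.+-inverseˡ b)

  ·-comm : Commutative _·_
  ·-comm (a , b) (c , d) = cong₂ _,_
    (solve 5 (λ a b c d n → a :* c :+ b :* d :* n := c :* a :+ d :* b :* n) refl a b c d n)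
    (solve 5 (λ a b c d t → a :* d :+ b :* c :+ b :* d :* t := c :* b :+ d :* a :+ d :* b :* t)
       refl a b c d t)
    where open +-*-Solver

  ·-assoc : Associative _·_
  ·-assoc (a , b) (c , d) (e , f) = cong₂ _,_
    (solve 8 (λ a b c d e f t n →
        (a :* c :+ b :* d :* n) :* e :+ (a :* d :+ b :* c :+ b :* d :* t) :* f :* n
      := a :* (c :* e :+ d :* f :* n) :+ b :* (c :* f :+ d :* e :+ d :* f :* t) :* n) refl a b c d e f t n)
    (solve 8 (λ a b c d e f t n →
        (a :* c :+ b :* d :* n) :* f :+ (a :* d :+ b :* c :+ b :* d :* t) :* e
          :+ (a :* d :+ b :* c :+ b :* d :* t) :* f :* t
      := a :* (c :* f :+ d :* e :+ d :* f :* t) :+ b :* (c :* e :+ d :* f :* n)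
          :+ b :* (c :* f :+ d :* e :+ d :* f :* t) :* t) refl a b c d e f t n)
    where open +-*-Solver

  ·-identityˡ : LeftIdentity 1# _·_
  ·-identityˡ (a , b) = cong₂ _,_
    (solve 3 (λ a b n → con (+ 1) :* a :+ con (+ 0) :* b :* n := a) refl a b n)
    (solve 3 (λ a b t → con (+ 1) :* b :+ con (+ 0) :* a :+ con (+ 0) :* b :* t := b) refl a b t)
    where open +-*-Solver

  ·-distribˡ-+ : _·_ DistributesOverˡ _+_
  ·-distribˡ-+ (a , b) (c , d) (e , f) = cong₂ _,_
    (solve 7 (λ a b c d e f n →
        a :* (c :+ e) :+ b :* (d :+ f) :* n
      := (a :* c :+ b :* d :* n) :+ (a :* e :+ b :* f :* n)) refl a b c d e f n)
    (solve 7 (λ a b c d e f t →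
        a :* (d :+ f) :+ b :* (c :+ e) :+ b :* (d :+ f) :* t
      := (a :* d :+ b :* c :+ b :* d :* t) :+ (a :* f :+ b :* e :+ b :* f :* t)) refl a b c d e f t)
    where open +-*-Solver

  isCommutativeRing : IsCommutativeRing _≡_ _+_ _·_ -_ 0# 1#
  isCommutativeRing = record
    { isRing = record
      { +-isAbelianGroup = record
        { isGroup = record
          { isMonoid = record
            { isSemigroup = record { isMagma = isMagma _+_ ; assoc = +-assoc }
            ; identity = comm∧idˡ⇒id +-comm +-identityˡ
            }
          ; inverse = comm∧invˡ⇒inv +-comm -‿inverseˡ
          ; ⁻¹-cong = cong (-_)
          }
        ; comm = +-comm
        }
      ; *-cong = cong₂ _·_
      ; *-assoc = ·-assoc
      ; *-identity = comm∧idˡ⇒id ·-comm ·-identityˡ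
      ; distrib = ·-distribˡ-+ , comm∧distrˡ⇒distrʳ ·-comm ·-distribˡ-+
      }
    ; *-comm = ·-comm
    }

  commutativeRing : CommutativeRing _ _
  commutativeRing = record { isCommutativeRing = isCommutativeRing }

  ·-identityʳ : RightIdentity 1# _·_
  ·-identityʳ = CommutativeRing.*-identityʳ commutativeRing

  conj-· : ∀ x y → conj (x · y) ≡ conj x · conj y
  conj-· (a , b) (c , d) = cong₂ _,_
    (solve 6 (λ a b c d t n →
        a :* c :+ b :* d :* n :+ (a :* d :+ b :* c :+ b :* d :* t) :* t
      := (a :+ b :* t) :* (c :+ d :* t) :+ :- b :* :- d :* n) refl a b c d t n)
    (solve 6 (λ a b c d t n →
        :- (a :* d :+ b :* c :+ b :* d :* t)
      := (a :+ b :* t) :* :- d :+ :- b :* (c :+ d :* t) :+ :- b :* :- d :* t) refl a b c d t n)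
    where open +-*-Solver

  ·-conj : ∀ x → x · conj x ≡ ι (norm x)
  ·-conj (a , b) = cong₂ _,_
    (solve 4 (λ a b t n →
        a :* (a :+ b :* t) :+ b :* :- b :* n := a :* a :+ a :* b :* t :+ :- (b :* b :* n)) refl a b t n)
    (solve 3 (λ a b t →
        a :* :- b :+ b :* (a :+ b :* t) :+ b :* :- b :* t := con (+ 0)) refl a b t)
    where open +-*-Solver

  norm-· : ∀ x y → norm (x · y) ≡ norm x ℤ.* norm y
  norm-· (a , b) (c , d) =
    solve 6 (λ a b c d t n →
        let ac = a :* c :+ b :* d :* n ; bd = a :* d :+ b :* c :+ b :* d :* t in
        ac :* ac :+ ac :* bd :* t :+ :- (bd :* bd :* n)
      := (a :* a :+ a :* b :* t :+ :- (b :* b :* n)) :* (c :* c :+ c :* d :* t :+ :- (d :* d :* n)))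
      refl a b c d t n
    where open +-*-Solver

  ι-· : ∀ c a b → ι c · (a , b) ≡ (c ℤ.* a , c ℤ.* b)
  ι-· c a b = cong₂ _,_
    (solve 4 (λ c a b n → c :* a :+ con (+ 0) :* b :* n := c :* a) refl c a b n)
    (solve 4 (λ c a b t → c :* b :+ con (+ 0) :* a :+ con (+ 0) :* b :* t := c :* b) refl c a b t)
    where open +-*-Solver

  d-rational : ∀ x → d x ≡ ι (proj₁ (d x))
  d-rational (a , b) =
    cong (proj₁ (d (a , b)) ,_) (solve 1 (λ b → b :+ :- b :+ con (+ 0) := con (+ 0)) refl b)
    where open +-*-Solver

  ∣ᴷ-0# : ∀ {m} → m ∣ᴷ 0#
  ∣ᴷ-0# {m} = ℤS.divides (+ 0) refl , ℤS.divides (+ 0) refl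

  ∣ᴷ-+ : ∀ {m x y} → m ∣ᴷ x → m ∣ᴷ y → m ∣ᴷ x + y
  ∣ᴷ-+ (m∣a , m∣b) (m∣c , m∣d) = ℤS.∣m∣n⇒∣m+n m∣a m∣c , ℤS.∣m∣n⇒∣m+n m∣b m∣d

  ∣ᴷ-+-cancelʳ : ∀ {m x} y → m ∣ᴷ x + y → m ∣ᴷ y → m ∣ᴷ x
  ∣ᴷ-+-cancelʳ _ (m∣a+c , m∣b+d) (m∣c , m∣d) =
    ℤS.∣m+n∣n⇒∣m m∣a+c m∣c , ℤS.∣m+n∣n⇒∣m m∣b+d m∣d

  ∣ᴷ-·ˡ : ∀ {m} x {y} → m ∣ᴷ y → m ∣ᴷ x · y
  ∣ᴷ-·ˡ (a , b) (m∣c , m∣d) =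
    ℤS.∣m∣n⇒∣m+n (ℤS.∣n⇒∣m*n a m∣c) (ℤS.∣m⇒∣m*n n (ℤS.∣n⇒∣m*n b m∣d)) ,
    ℤS.∣m∣n⇒∣m+n (ℤS.∣m∣n⇒∣m+n (ℤS.∣n⇒∣m*n a m∣d) (ℤS.∣n⇒∣m*n b m∣c))
                 (ℤS.∣m⇒∣m*n t (ℤS.∣n⇒∣m*n b m∣d))

  ∣ᴷ-·ʳ : ∀ {m x} y → m ∣ᴷ x → m ∣ᴷ x · y
  ∣ᴷ-·ʳ {x = x} y m∣x = subst (_ ∣ᴷ_) (·-comm y x) (∣ᴷ-·ˡ y m∣x)

  ∣ᴷ-·-· : ∀ {m n x y} → m ∣ᴷ x → n ∣ᴷ y → m ℤ.* n ∣ᴷ x · y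
  ∣ᴷ-·-· (m∣a , m∣b) (n∣c , n∣d) =
    ℤS.∣m∣n⇒∣m+n (*-pres-∣ℤ m∣a n∣c) (ℤS.∣m⇒∣m*n n (*-pres-∣ℤ m∣b n∣d)) ,
    ℤS.∣m∣n⇒∣m+n (ℤS.∣m∣n⇒∣m+n (*-pres-∣ℤ m∣a n∣d) (*-pres-∣ℤ m∣b n∣c))
                 (ℤS.∣m⇒∣m*n t (*-pres-∣ℤ m∣b n∣d))

  ∣ᴷ-∣ : ∀ {m M x} → m ℤS.∣ M → M ∣ᴷ x → m ∣ᴷ x
  ∣ᴷ-∣ m∣M (M∣a , M∣b) = ℤS.∣-trans m∣M M∣a , ℤS.∣-trans m∣M M∣b

  ∣ᴷ-ι-·⇒∣∨∣ᴷ : ∀ {p} c z → Prime p → + p ∣ᴷ ι c · z → + p ℤS.∣ c ⊎ + p ∣ᴷ z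
  ∣ᴷ-ι-·⇒∣∨∣ᴷ c (a , b) p-prime p∣cz with subst (_ ∣ᴷ_) (ι-· c a b) p∣cz
  ... | p∣ca , p∣cb with euclidsLemmaℤ c a p-prime p∣ca | euclidsLemmaℤ c b p-prime p∣cb
  ...   | inj₁ p∣c | _        = inj₁ p∣c
  ...   | inj₂ _   | inj₁ p∣c = inj₁ p∣c
  ...   | inj₂ p∣a | inj₂ p∣b = inj₂ (p∣a , p∣b)

  ∣ᴷ-ι-·-cancel : ∀ {p} c z → Prime p → ¬ + p ℤS.∣ c →
                  + p ∣ᴷ z → + p ℤ.* + p ∣ᴷ ι c · z → + p ℤ.* + p ∣ᴷ z
  ∣ᴷ-ι-·-cancel c (a , b) p-prime p∤c (p∣a , p∣b) pp∣cz
    with subst (_ ∣ᴷ_) (ι-· c a b) pp∣cz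
  ... | pp∣ca , pp∣cb =
    p∣a∧p*p∣c*a⇒p*p∣a p-prime p∤c p∣a pp∣ca , p∣a∧p*p∣c*a⇒p*p∣a p-prime p∤c p∣b pp∣cb

module RingOfIntegers (D : ℕ) where
  open QuadraticRing (tr D) (nm D) public
  open RingSolver (ACR.fromCommutativeRing commutativeRing) (Product.≡-dec ℤ._≟_ ℤ._≟_)
    using (solve; _:=_; _:+_; _:-_; _:*_; _:^_; con)

  infixr 8 _^ᴷ_
  _^ᴷ_ : OK → ℕ → OK
  x ^ᴷ k = powK D x k

  ^ᴷ-+ : ∀ x a b → x ^ᴷ (a ℕ.+ b) ≡ x ^ᴷ a · x ^ᴷ b
  ^ᴷ-+ x zero    b = sym (·-identityˡ (x ^ᴷ b))
  ^ᴷ-+ x (suc a) b = trans (cong (x ·_) (^ᴷ-+ x a b)) (sym (·-assoc x (x ^ᴷ a) (x ^ᴷ b)))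

  ^ᴷ-* : ∀ x a b → x ^ᴷ (a * b) ≡ (x ^ᴷ b) ^ᴷ a
  ^ᴷ-* x zero    b = refl
  ^ᴷ-* x (suc a) b = trans (^ᴷ-+ x b (a * b)) (cong (x ^ᴷ b ·_) (^ᴷ-* x a b))

  ^ᴷ-comm : ∀ x a b → (x ^ᴷ a) ^ᴷ b ≡ (x ^ᴷ b) ^ᴷ a
  ^ᴷ-comm x a b = trans (sym (^ᴷ-* x b a)) (trans (cong (x ^ᴷ_) (ℕP.*-comm b a)) (^ᴷ-* x a b))

  conj-^ᴷ : ∀ x k → conj (x ^ᴷ k) ≡ conj x ^ᴷ k
  conj-^ᴷ x zero    = refl
  conj-^ᴷ x (suc k) = trans (conj-· x (x ^ᴷ k)) (cong (conj x ·_) (conj-^ᴷ x k))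

  norm-^ᴷ : ∀ x k → norm x ≡ + 1 → norm (x ^ᴷ k) ≡ + 1
  norm-^ᴷ x zero    _    = refl
  norm-^ᴷ x (suc k) Nx≡1 = trans (norm-· x (x ^ᴷ k)) (cong₂ ℤ._*_ Nx≡1 (norm-^ᴷ x k Nx≡1))

  ·-conj≡1 : ∀ x → norm x ≡ + 1 → x · conj x ≡ 1#
  ·-conj≡1 x Nx≡1 = trans (·-conj x) (cong ι Nx≡1)

  dK≡d : ∀ v → norm v ≡ + 1 → ∀ k → dK D v k ≡ d (v ^ᴷ k)
  dK≡d v Nv≡1 k =
    cong (λ y → v ^ᴷ k + y + 1#) (trans (cong (_^ᴷ k) invK≡conj) (sym (conj-^ᴷ v k)))
    where
      invK≡conj : invK D v ≡ conj v
      invK≡conj = trans (cong (λ c → scaleK c (conj v)) Nv≡1)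
                        (cong₂ _,_ (ℤP.*-identityˡ _) (ℤP.*-identityˡ _))

  ·-1# : ∀ x y → x · y - 1# ≡ (x - 1#) + x · (y - 1#)
  ·-1# = solve 2 (λ x y → x :* y :- con 1# := (x :- con 1#) :+ x :* (y :- con 1#)) refl

  ∣ᴷ-·-1# : ∀ {m} x y → m ∣ᴷ x - 1# → m ∣ᴷ y - 1# → m ∣ᴷ x · y - 1#
  ∣ᴷ-·-1# x y m∣x-1 m∣y-1 = subst (_ ∣ᴷ_) (sym (·-1# x y)) (∣ᴷ-+ m∣x-1 (∣ᴷ-·ˡ x m∣y-1))

  ∣ᴷ-·-1#-cancelʳ : ∀ {m} x y → m ∣ᴷ y - 1# → m ∣ᴷ x · y - 1# → m ∣ᴷ x - 1#
  ∣ᴷ-·-1#-cancelʳ x y m∣y-1 m∣xy-1 =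
    ∣ᴷ-+-cancelʳ (x · (y - 1#)) (subst (_ ∣ᴷ_) (·-1# x y) m∣xy-1) (∣ᴷ-·ˡ x m∣y-1)

  ∣ᴷ-^ᴷ-1# : ∀ {m} x k → m ∣ᴷ x - 1# → m ∣ᴷ x ^ᴷ k - 1#
  ∣ᴷ-^ᴷ-1# x zero    _      = ∣ᴷ-0#
  ∣ᴷ-^ᴷ-1# x (suc k) m∣x-1 = ∣ᴷ-·-1# x (x ^ᴷ k) m∣x-1 (∣ᴷ-^ᴷ-1# x k m∣x-1)

  ∣ᴷ-^ᴷ-1#-∣ : ∀ {m} x {T a} → m ∣ᴷ x ^ᴷ T - 1# → T ∣ a → m ∣ᴷ x ^ᴷ a - 1#
  ∣ᴷ-^ᴷ-1#-∣ x {T} m∣xᵀ-1 (divides c refl) =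
    subst (λ y → _ ∣ᴷ y - 1#) (sym (^ᴷ-* x c T)) (∣ᴷ-^ᴷ-1# (x ^ᴷ T) c m∣xᵀ-1)

  IsOrd-∣ : ∀ {m x T} → IsOrd D m x T → ∀ a → m ∣ᴷ x ^ᴷ a - 1# → T ∣ a
  IsOrd-∣ {m} {x} {T@(suc _)} (_ , m∣xᵀ-1 , minimal) a m∣xᵃ-1 =
    m%n≡0⇒n∣m a T (decidable-stable (a % T ℕ.≟ 0) r≢0-impossible)
    where
      r : ℕ
      r = a % T
      xᵃ≡xʳ·[xᵀ]^q : x ^ᴷ a ≡ x ^ᴷ r · (x ^ᴷ T) ^ᴷ (a / T)
      xᵃ≡xʳ·[xᵀ]^q = trans (cong (x ^ᴷ_) (m≡m%n+[m/n]*n a T))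
                            (trans (^ᴷ-+ x r (a / T * T)) (cong (x ^ᴷ r ·_) (^ᴷ-* x (a / T) T)))
      m∣xʳ-1 : m ∣ᴷ x ^ᴷ r - 1#
      m∣xʳ-1 = ∣ᴷ-·-1#-cancelʳ (x ^ᴷ r) ((x ^ᴷ T) ^ᴷ (a / T))
                 (∣ᴷ-^ᴷ-1# (x ^ᴷ T) (a / T) (DivK⇒∣ᴷ m∣xᵀ-1))
                 (subst (λ y → m ∣ᴷ y - 1#) xᵃ≡xʳ·[xᵀ]^q m∣xᵃ-1)
      r≢0-impossible : ¬ ¬ r ≡ 0
      r≢0-impossible r≢0 = minimal r (ℕP.n≢0⇒n>0 r≢0) (m%n<n a T) (∣ᴷ⇒DivK m∣xʳ-1)

  ∃IsOrd : ∀ {m} x {N} → 1 ≤ N → m ∣ᴷ x ^ᴷ N - 1# → ∃ (IsOrd D m x)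
  ∃IsOrd {m} x 1≤N m∣xᴺ-1
    with least (λ k → (1 ℕ.≤? k) ×-dec ∣ᴷ? m (x ^ᴷ k - 1#)) (1≤N , m∣xᴺ-1)
  ... | T , (1≤T , m∣xᵀ-1) , below =
    T , 1≤T , ∣ᴷ⇒DivK m∣xᵀ-1 ,
    λ k 1≤k k<T m∣xᵏ-1 → below k<T (1≤k , DivK⇒∣ᴷ m∣xᵏ-1)

  IsOrd-lift : ∀ {m M x T} → m ℤS.∣ M → IsOrd D m x T → M ∣ᴷ x ^ᴷ T - 1# → IsOrd D M x T
  IsOrd-lift {x = x} m∣M (1≤T , _ , minimal) M∣xᵀ-1 =
    1≤T , ∣ᴷ⇒DivK M∣xᵀ-1 ,
    λ k 1≤k k<T M∣xᵏ-1 →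
      minimal k 1≤k k<T (∣ᴷ⇒DivK (∣ᴷ-∣ m∣M (DivK⇒∣ᴷ {x = x ^ᴷ k - 1#} M∣xᵏ-1)))

  ∣ᴷ-1#-·conj : ∀ {m} x → x · conj x ≡ 1# → m ∣ᴷ 1# - x · conj x
  ∣ᴷ-1#-·conj x x·x̄≡1 = subst (λ y → _ ∣ᴷ 1# - y) (sym x·x̄≡1) ∣ᴷ-0#

  cube-1# : ∀ x → x ^ᴷ 3 - 1# ≡ (x - 1#) · x · d x + (x - 1#) · (1# - x · conj x)
  cube-1# x = solve 2 (λ x x̄ →
      x :^ 3 :- con 1#
    := (x :- con 1#) :* x :* (x :+ x̄ :+ con 1#) :+ (x :- con 1#) :* (con 1# :- x :* x̄))
    refl x (conj x)

  three-via-d : ∀ x → ι (+ 3) ≡ d x + (x - 1#) · (conj x - 1#) + (1# - x · conj x)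
  three-via-d x = solve 2 (λ x x̄ →
      con (ι (+ 3))
    := (x :+ x̄ :+ con 1#) :+ (x :- con 1#) :* (x̄ :- con 1#) :+ (con 1# :- x :* x̄)) refl x (conj x)

  ∣d⇒cube≡1 : ∀ {m} x → x · conj x ≡ 1# → m ∣ᴷ d x → m ∣ᴷ x ^ᴷ 3 - 1#
  ∣d⇒cube≡1 x x·x̄≡1 m∣dx = subst (_ ∣ᴷ_) (sym (cube-1# x))
    (∣ᴷ-+ (∣ᴷ-·ˡ ((x - 1#) · x) m∣dx) (∣ᴷ-·ˡ (x - 1#) (∣ᴷ-1#-·conj x x·x̄≡1)))

  ∣d∧≡1⇒∣3 : ∀ {m} x → x · conj x ≡ 1# → m ∣ᴷ d x → m ∣ᴷ x - 1# → m ℤS.∣ + 3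
  ∣d∧≡1⇒∣3 x x·x̄≡1 m∣dx m∣x-1 = _∣ᴷ_.∣proj₁ (subst (_ ∣ᴷ_) (sym (three-via-d x))
    (∣ᴷ-+ (∣ᴷ-+ m∣dx (∣ᴷ-·ʳ (conj x - 1#) m∣x-1)) (∣ᴷ-1#-·conj x x·x̄≡1)))

  cube≡1∧≢1⇒∣d : ∀ {p} x → Prime p → x · conj x ≡ 1# →
                 + p ∣ᴷ x ^ᴷ 3 - 1# → ¬ + p ∣ᴷ x - 1# → + p ∣ᴷ d x
  cube≡1∧≢1⇒∣d {p} x p-prime x·x̄≡1 p∣x³-1 p∤x-1 =
    Sum.[ (λ p∣c → subst (+ p ∣ᴷ_) (sym (d-rational x)) (p∣c , ℤS.divides (+ 0) refl))
        , (λ p∣[x-1]·x →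
             ⊥-elim (p∤x-1 (subst (+ p ∣ᴷ_) [x-1]·x·x̄≡x-1 (∣ᴷ-·ʳ (conj x) p∣[x-1]·x))))
        ]′ (∣ᴷ-ι-·⇒∣∨∣ᴷ c ((x - 1#) · x) p-prime p∣c·[x-1]x)
    where
      c : ℤ
      c = proj₁ (d x)
      p∣c·[x-1]x : + p ∣ᴷ ι c · ((x - 1#) · x)
      p∣c·[x-1]x = subst (+ p ∣ᴷ_)
        (trans (cong ((x - 1#) · x ·_) (d-rational x)) (·-comm ((x - 1#) · x) (ι c)))
        (∣ᴷ-+-cancelʳ ((x - 1#) · (1# - x · conj x)) (subst (+ p ∣ᴷ_) (cube-1# x) p∣x³-1)
          (∣ᴷ-·ˡ (x - 1#) (∣ᴷ-1#-·conj x x·x̄≡1)))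
      [x-1]·x·x̄≡x-1 : (x - 1#) · x · conj x ≡ x - 1#
      [x-1]·x·x̄≡x-1 = trans (·-assoc (x - 1#) x (conj x))
                             (trans (cong ((x - 1#) ·_) x·x̄≡1) (·-identityʳ (x - 1#)))

  square-1# : ∀ w → w ^ᴷ 2 - 1# ≡ ι (+ 2) · (w - 1#) + (w - 1#) · (w - 1#)
  square-1# = solve 1 (λ w →
      w :^ 2 :- con 1#
    := con (ι (+ 2)) :* (w :- con 1#) :+ (w :- con 1#) :* (w :- con 1#)) refl

  ∣ᴷ-square-1#⇒∣ᴷ-1# : ∀ {p} w → Prime p → ¬ p ∣ 2 →
                       + p ∣ᴷ w - 1# → + (p ^ 2) ∣ᴷ w ^ᴷ 2 - 1# → + (p ^ 2) ∣ᴷ w - 1#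
  ∣ᴷ-square-1#⇒∣ᴷ-1# {p} w p-prime p∤2 p∣w-1 p²∣w²-1 = subst (_∣ᴷ w - 1#) (sym p^2≡p*p)
    (∣ᴷ-ι-·-cancel (+ 2) (w - 1#) p-prime (p∤2 ∘ ℤS.∣⇒∣ᵤ) p∣w-1
      (∣ᴷ-+-cancelʳ ((w - 1#) · (w - 1#)) (subst₂ _∣ᴷ_ p^2≡p*p (square-1# w) p²∣w²-1)
                    (∣ᴷ-·-· p∣w-1 p∣w-1)))
    where
      p^2≡p*p : + (p ^ 2) ≡ + p ℤ.* + p
      p^2≡p*p = trans (cong (λ k → + (p * k)) (ℕP.*-identityʳ p)) (ℤP.pos-* p p)

  UDShape : OK → OK → Set
  UDShape uK uD = ∃ λ m → (m ≡ 1 ⊎ m ≡ 2) × uD ≡ uK ^ᴷ m × norm uD ≡ + 1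

  -- Whether K has a unit of norm -1 is not decidable, so only the double negation of
  -- this case split is available; it is used only to prove decidable congruences.
  uD-shape : ∀ {uK uD} → IsUnit D uK → IsUD D uK uD → ¬ ¬ UDShape uK uD
  uD-shape {uK} {uD} uK-unit (has⇒uD≡uK² , ¬has⇒uD≡uK) ¬shape =
    ¬shape (1 , inj₁ refl , trans (¬has⇒uD≡uK ¬has) (sym (·-identityʳ uK)) ,
            trans (cong norm (¬has⇒uD≡uK ¬has)) NuK≡1)
    where
      unit² : ∀ {c} → c ≡ + 1 ⊎ c ≡ ℤ.- + 1 → c ℤ.* c ≡ + 1
      unit² (inj₁ refl) = refl
      unit² (inj₂ refl) = refl
      ¬has : ¬ HasNormMinusOneUnit D
      ¬has has = ¬shape (2 , inj₂ refl , trans (has⇒uD≡uK² has) (cong (uK ·_) (sym (·-identityʳ uK))) ,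
                         trans (cong norm (has⇒uD≡uK² has)) (trans (norm-· uK uK) (unit² uK-unit)))
      NuK≡1 : norm uK ≡ + 1
      NuK≡1 = Sum.[ id , (λ NuK≡-1 → ⊥-elim (¬has (uK , NuK≡-1))) ]′ uK-unit

module Hypotheses
  (D p : ℕ) (p-prime : Prime p) (p∤2 : ¬ p ∣ 2) (p∤3 : ¬ p ∣ 3)
  (uK uD : OK) (shape : RingOfIntegers.UDShape D uK uD)
  (ℓ : ℕ) (1≤ℓ : 1 ≤ ℓ) (p∣dℓ : DivK (+ p) (dK D uD ℓ))
  (ℓ-least : ∀ k → 1 ≤ k → k < ℓ → ¬ DivK (+ p) (dK D uD k))
  (p²∣dℓ : DivK (+ (p ^ 2)) (dK D uD ℓ))
  where
  open RingOfIntegers D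

  m : ℕ
  m = proj₁ shape

  m≡1∨2 : m ≡ 1 ⊎ m ≡ 2
  m≡1∨2 = proj₁ (proj₂ shape)

  uD≡uKᵐ : uD ≡ uK ^ᴷ m
  uD≡uKᵐ = proj₁ (proj₂ (proj₂ shape))

  NuD≡1 : norm uD ≡ + 1
  NuD≡1 = proj₂ (proj₂ (proj₂ shape))

  uDᵏ·conj≡1 : ∀ k → uD ^ᴷ k · conj (uD ^ᴷ k) ≡ 1#
  uDᵏ·conj≡1 k = ·-conj≡1 (uD ^ᴷ k) (norm-^ᴷ uD k NuD≡1)

  ∣dK⇒∣ᴷd : ∀ {M} k → DivK M (dK D uD k) → M ∣ᴷ d (uD ^ᴷ k)
  ∣dK⇒∣ᴷd {M} k M∣dK = DivK⇒∣ᴷ (subst (DivK M) (dK≡d uD NuD≡1 k) M∣dK)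

  ∣dℓ⇒uD³ˡ≡1 : ∀ {M} → DivK M (dK D uD ℓ) → M ∣ᴷ uD ^ᴷ (3 * ℓ) - 1#
  ∣dℓ⇒uD³ˡ≡1 M∣dℓ = subst (λ y → _ ∣ᴷ y - 1#) (sym (^ᴷ-* uD 3 ℓ))
    (∣d⇒cube≡1 (uD ^ᴷ ℓ) (uDᵏ·conj≡1 ℓ) (∣dK⇒∣ᴷd ℓ M∣dℓ))

  ord∤ℓ : ∀ {t} → IsOrd D (+ p) uD t → ¬ t ∣ ℓ
  ord∤ℓ (_ , p∣uDᵗ-1 , _) t∣ℓ = p∤3 (ℤS.∣⇒∣ᵤ
    (∣d∧≡1⇒∣3 (uD ^ᴷ ℓ) (uDᵏ·conj≡1 ℓ) (∣dK⇒∣ᴷd ℓ p∣dℓ) (∣ᴷ-^ᴷ-1#-∣ uD (DivK⇒∣ᴷ {+ p} p∣uDᵗ-1) t∣ℓ)))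

  ord≡3s⇒s≡ℓ : ∀ {s} → IsOrd D (+ p) uD (3 * s) → s ∣ ℓ → s ≡ ℓ
  ord≡3s⇒s≡ℓ {s} (1≤3s , p∣uD³ˢ-1 , minimal) s∣ℓ =
    ℕP.≤-antisym (∣⇒≤ {{ℕ.>-nonZero 1≤ℓ}} s∣ℓ) (ℕP.≮⇒≥ s≮ℓ)
    where
      1≤s : 1 ≤ s
      1≤s = ℕP.n≢0⇒n>0 λ { refl → ℕP.<-irrefl refl 1≤3s }
      s<3s : s < 3 * s
      s<3s = subst (s <_) (ℕP.*-comm s 3) (ℕP.m<m*n s 3 {{ℕ.>-nonZero 1≤s}} (s≤s (s≤s z≤n)))
      p∣d[uDˢ] : + p ∣ᴷ d (uD ^ᴷ s)
      p∣d[uDˢ] = cube≡1∧≢1⇒∣d (uD ^ᴷ s) p-prime (uDᵏ·conj≡1 s)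
        (subst (λ y → + p ∣ᴷ y - 1#) (^ᴷ-* uD 3 s) (DivK⇒∣ᴷ p∣uD³ˢ-1))
        (λ p∣uDˢ-1 → minimal s 1≤s s<3s (∣ᴷ⇒DivK p∣uDˢ-1))
      s≮ℓ : ¬ s < ℓ
      s≮ℓ s<ℓ = ℓ-least s 1≤s s<ℓ
        (subst (DivK (+ p)) (sym (dK≡d uD NuD≡1 s)) (∣ᴷ⇒DivK p∣d[uDˢ]))

  1≤3ℓ : 1 ≤ 3 * ℓ
  1≤3ℓ = ℕP.≤-trans 1≤ℓ (ℕP.m≤n*m ℓ 3)

  ord-uD : IsOrd D (+ p) uD (3 * ℓ)
  ord-uD = subst (λ k → IsOrd D (+ p) uD (3 * k)) (ord≡3s⇒s≡ℓ ord-3s s∣ℓ) ord-3s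
    where
      p∣uD³ˡ-1 : + p ∣ᴷ uD ^ᴷ (3 * ℓ) - 1#
      p∣uD³ˡ-1 = ∣dℓ⇒uD³ˡ≡1 p∣dℓ
      order : ∃ (IsOrd D (+ p) uD)
      order = ∃IsOrd uD 1≤3ℓ p∣uD³ˡ-1
      t : ℕ
      t = proj₁ order
      split : ∃ λ s → t ≡ 3 * s × s ∣ ℓ
      split = ∣p*n∧∤n⇒≡p* (from-yes (prime? 3))
                (IsOrd-∣ (proj₂ order) (3 * ℓ) p∣uD³ˡ-1) (ord∤ℓ (proj₂ order))
      s∣ℓ : proj₁ split ∣ ℓ
      s∣ℓ = proj₂ (proj₂ split)
      ord-3s : IsOrd D (+ p) uD (3 * proj₁ split)
      ord-3s = subst (IsOrd D (+ p) uD) (proj₁ (proj₂ split)) (proj₂ order)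

  uD-lifts : ∀ n → + p ∣ᴷ uD ^ᴷ n - 1# → + (p ^ 2) ∣ᴷ uD ^ᴷ n - 1#
  uD-lifts n p∣uDⁿ-1 = ∣ᴷ-^ᴷ-1#-∣ uD (∣dℓ⇒uD³ˡ≡1 p²∣dℓ) (IsOrd-∣ ord-uD n p∣uDⁿ-1)

  uK-lifts : ∀ n → + p ∣ᴷ uK ^ᴷ n - 1# → + (p ^ 2) ∣ᴷ uK ^ᴷ n - 1#
  uK-lifts n p∣uKⁿ-1 = root m≡1∨2 (subst (λ y → _ ∣ᴷ y - 1#) uDⁿ≡[uKⁿ]ᵐ (uD-lifts n p∣uDⁿ-1))
    where
      uDⁿ≡[uKⁿ]ᵐ : uD ^ᴷ n ≡ (uK ^ᴷ n) ^ᴷ m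
      uDⁿ≡[uKⁿ]ᵐ = trans (cong (_^ᴷ n) uD≡uKᵐ) (^ᴷ-comm uK m n)
      p∣uDⁿ-1 : + p ∣ᴷ uD ^ᴷ n - 1#
      p∣uDⁿ-1 = subst (λ y → _ ∣ᴷ y - 1#) (sym uDⁿ≡[uKⁿ]ᵐ) (∣ᴷ-^ᴷ-1# (uK ^ᴷ n) m p∣uKⁿ-1)
      root : ∀ {e} → e ≡ 1 ⊎ e ≡ 2 → + (p ^ 2) ∣ᴷ (uK ^ᴷ n) ^ᴷ e - 1# → + (p ^ 2) ∣ᴷ uK ^ᴷ n - 1#
      root (inj₁ refl) = subst (λ y → _ ∣ᴷ y - 1#) (·-identityʳ (uK ^ᴷ n))
      root (inj₂ refl) = ∣ᴷ-square-1#⇒∣ᴷ-1# (uK ^ᴷ n) p-prime p∤2 p∣uKⁿ-1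

  uK⁶ˡ≡1 : + p ∣ᴷ uK ^ᴷ (3 * ℓ * 2) - 1#
  uK⁶ˡ≡1 = ∣ᴷ-^ᴷ-1#-∣ uK p∣uK³ˡᵐ-1 (*-monoʳ-∣ (3 * ℓ) (m∣2 m≡1∨2))
    where
      p∣uK³ˡᵐ-1 : + p ∣ᴷ uK ^ᴷ (3 * ℓ * m) - 1#
      p∣uK³ˡᵐ-1 = subst (λ y → _ ∣ᴷ y - 1#) (trans (cong (_^ᴷ (3 * ℓ)) uD≡uKᵐ) (sym (^ᴷ-* uK (3 * ℓ) m)))
                        (DivK⇒∣ᴷ {+ p} (proj₁ (proj₂ ord-uD)))
      m∣2 : ∀ {e} → e ≡ 1 ⊎ e ≡ 2 → e ∣ 2
      m∣2 (inj₁ refl) = 1∣ 2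
      m∣2 (inj₂ refl) = ∣-refl

proposition3p1 : (D : ℕ) → 2 ≤ D → SquareFree D →
    (uK : OK) → IsFundamentalUnit D uK →
    (uD : OK) → IsUD D uK uD →
    (p : ℕ) → Prime p → gcd p (6 * D) ≡ 1 →
    (∃ λ (k : ℕ) → 1 ≤ k × DivK (+ p) (dK D uD k)) →
    (ℓ : ℕ) → 1 ≤ ℓ → DivK (+ p) (dK D uD ℓ) →
    (∀ (k : ℕ) → 1 ≤ k → k < ℓ → ¬ DivK (+ p) (dK D uD k)) →
    DivK (+ (p ^ 2)) (dK D uD ℓ) →
    ∃ λ (n : ℕ) → IsOrd D (+ p) uK n × IsOrd D (+ (p ^ 2)) uK n
proposition3p1 D _ _ uK (uK-unit , _) uD uD-def p p-prime gcd≡1 _ ℓ 1≤ℓ p∣dℓ ℓ-least p²∣dℓ =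
  n , ord-p , IsOrd-lift p∣p² ord-p (stable (¬¬-map (λ s → Case.uK-lifts s n p∣uKⁿ-1) shape))
  where
    open RingOfIntegers D

    p∤2 : ¬ p ∣ 2
    p∤2 = gcd≡1∧k∣n⇒p∤k p-prime gcd≡1 (∣-trans (divides 3 refl) (m∣m*n D))

    p∤3 : ¬ p ∣ 3
    p∤3 = gcd≡1∧k∣n⇒p∤k p-prime gcd≡1 (∣-trans (divides 2 refl) (m∣m*n D))

    module Case (s : UDShape uK uD) =
      Hypotheses D p p-prime p∤2 p∤3 uK uD s ℓ 1≤ℓ p∣dℓ ℓ-least p²∣dℓ

    shape : ¬ ¬ UDShape uK uD
    shape = uD-shape uK-unit uD-def

    stable : ∀ {M x} → ¬ ¬ M ∣ᴷ x → M ∣ᴷ x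
    stable = decidable-stable (∣ᴷ? _ _)

    1≤6ℓ : 1 ≤ 3 * ℓ * 2
    1≤6ℓ = ℕP.≤-trans 1≤ℓ (ℕP.≤-trans (ℕP.m≤n*m ℓ 3) (ℕP.m≤m*n (3 * ℓ) 2))

    order : ∃ (IsOrd D (+ p) uK)
    order = ∃IsOrd uK 1≤6ℓ (stable (¬¬-map Case.uK⁶ˡ≡1 shape))

    n : ℕ
    n = proj₁ order

    ord-p : IsOrd D (+ p) uK n
    ord-p = proj₂ order

    p∣uKⁿ-1 : + p ∣ᴷ uK ^ᴷ n - 1#
    p∣uKⁿ-1 = DivK⇒∣ᴷ (proj₁ (proj₂ ord-p))

    p∣p² : + p ℤS.∣ + (p ^ 2)
    p∣p² = ℤS.∣ᵤ⇒∣ {+ p} {+ (p ^ 2)} (m∣m*n (p * 1))
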